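{- Let $(K,+,\cdot,0,1)$ be an absorptive semiring, let $\pi\colon\mathrm{Lit}_A(\tau)\to K$ be a $K$-interpretation on a finite universe $A$, and let $\pi_{\inf}$ be the same map regarded as an interpretation into $K_{\inf}=(K,+,\sqcap,0,1)$. Then for every first-order formula $\psi(\bar x)$ (in negation normal form) and every tuple $\bar a$ over $A$: (i) $\pi[\![\psi(\bar a)]\!]\le_K\pi_{\inf}[\![\psi(\bar a)]\!]$; (ii) $\pi_{\inf}[\![\psi(\bar a)]\!]=1$ if, and only if, $\pi[\![\psi(\bar a)]\!]=1$.
   Context: A commutative semiring $K$ is absorptive if $a+ab=a$ for all $a,b\in K$; then $+$ is idempotent and $a\le_K b:\Leftrightarrow a+b=b$ is a partial order (the natural order), with $+$ the supremum. $K_{\inf}=(K,+,\sqcap,0,1)$ is the lattice semiring on the same domain in which multiplication is replaced by the infimum $\sqcap$ of the natural order (assumed to exist). $\tau$ is a finite relational vocabulary; a $K$-interpretation $\pi$ maps the instantiated literals $R\bar a,\neg R\bar a$ over $A$ to $K$ with exactly one of $\pi(\alpha),\pi(\neg\alpha)$ equal to $0$ per atom; it extends to formulae in negation normal form by valuing (in)equalities by $1/0$ according to truth, literals by $\pi$, $\lor$ by $+$, $\land$ by the semiring multiplication, $\exists$ by sum and $\forall$ by product over $A$ (in $K_{\inf}$ the multiplication is $\sqcap$). -}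

module Defs where

open import Level using (Level; _⊔_)
open import Data.Nat using (ℕ; suc)
open import Data.Fin using (Fin; zero; suc)
open import Data.Fin.Properties using (_≟_)
open import Data.Vec using (Vec; lookup; map; _∷_)
open import Data.Product using (_×_)
open import Data.Sum using (_⊎_)
open import Relation.Nullary using (¬_; yes; no)
open import Algebra.Bundles using (CommutativeSemiring)

module _ {c ℓ} (K : CommutativeSemiring c ℓ) where
  open CommutativeSemiring K hiding (zero)

  Absorptive : Set (c ⊔ ℓ)
  Absorptive = ∀ a b → (a + (a * b)) ≈ a

  _≤K_ : Carrier → Carrier → Set ℓ
  a ≤K b = (a + b) ≈ b

  IsInfimum : (Carrier → Carrier → Carrier) → Set (c ⊔ ℓ)
  IsInfimum _⊓_ = ∀ a b →
      ((a ⊓ b) ≤K a) × ((a ⊓ b) ≤K b) × (∀ d → d ≤K a → d ≤K b → d ≤K (a ⊓ b))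

record Vocabulary : Set where
  field
    nsym : ℕ
    ar   : Fin nsym → ℕ
open Vocabulary public

-- First-order formulae in negation normal form, with k free variables
-- (de Bruijn: variables are Fin k; quantifiers bind variable zero).
data Formula (τ : Vocabulary) : ℕ → Set where
  eq   : ∀ {k} → Fin k → Fin k → Formula τ k
  neq  : ∀ {k} → Fin k → Fin k → Formula τ k
  pos  : ∀ {k} (R : Fin (nsym τ)) → Vec (Fin k) (ar τ R) → Formula τ k
  neg  : ∀ {k} (R : Fin (nsym τ)) → Vec (Fin k) (ar τ R) → Formula τ k
  _∨_  : ∀ {k} → Formula τ k → Formula τ k → Formula τ k
  _∧_  : ∀ {k} → Formula τ k → Formula τ k → Formula τ k
  ex   : ∀ {k} → Formula τ (suc k) → Formula τ k
  all  : ∀ {k} → Formula τ (suc k) → Formula τ k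

module _ {c ℓ} (K : CommutativeSemiring c ℓ) where
  open CommutativeSemiring K hiding (zero)

  record Interpretation (τ : Vocabulary) (n : ℕ) : Set (c ⊔ ℓ) where
    field
      posLit : (R : Fin (nsym τ)) → Vec (Fin n) (ar τ R) → Carrier
      negLit : (R : Fin (nsym τ)) → Vec (Fin n) (ar τ R) → Carrier
      exactlyOne : ∀ R as →
        ((posLit R as ≈ 0#) × ¬ (negLit R as ≈ 0#)) ⊎
        (¬ (posLit R as ≈ 0#) × (negLit R as ≈ 0#))
  open Interpretation public

-- Semantics, parametrised by the multiplication used for ∧ and ∀
-- (semiring product for π, infimum ⊓ for π_inf); + , 0 , 1 are K's.

module Semantics {c ℓ} (K : CommutativeSemiring c ℓ) where
  open CommutativeSemiring K hiding (zero)

  bigSum : ∀ {n} → (Fin n → Carrier) → Carrier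
  bigSum {ℕ.zero} f = 0#
  bigSum {suc n} f = f zero + bigSum (λ i → f (suc i))

  bigMul : (Carrier → Carrier → Carrier) → ∀ {n} → (Fin n → Carrier) → Carrier
  bigMul _·_ {ℕ.zero} f = 1#
  bigMul _·_ {suc n} f = f zero · bigMul _·_ (λ i → f (suc i))

  ⟦_⟧ : ∀ {τ n k} → Formula τ k → (Carrier → Carrier → Carrier) →
        Interpretation K τ n → Vec (Fin n) k → Carrier
  ⟦ eq x y ⟧ _·_ π as with lookup as x ≟ lookup as y
  ... | yes _ = 1#
  ... | no  _ = 0#
  ⟦ neq x y ⟧ _·_ π as with lookup as x ≟ lookup as y
  ... | yes _ = 0#
  ... | no  _ = 1#
  ⟦ pos R xs ⟧ _·_ π as = posLit π R (map (lookup as) xs)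
  ⟦ neg R xs ⟧ _·_ π as = negLit π R (map (lookup as) xs)
  ⟦ φ ∨ ψ ⟧ _·_ π as = ⟦ φ ⟧ _·_ π as + ⟦ ψ ⟧ _·_ π as
  ⟦ φ ∧ ψ ⟧ _·_ π as = ⟦ φ ⟧ _·_ π as · ⟦ ψ ⟧ _·_ π as
  ⟦ ex φ ⟧ _·_ π as = bigSum (λ a → ⟦ φ ⟧ _·_ π (a ∷ as))
  ⟦ all φ ⟧ _·_ π as = bigMul _·_ (λ a → ⟦ φ ⟧ _·_ π (a ∷ as))

  ⟦_⟧K : ∀ {τ n k} → Formula τ k → Interpretation K τ n → Vec (Fin n) k → Carrier
  ⟦ ψ ⟧K = ⟦ ψ ⟧ _*_

  ⟦_⟧inf : ∀ {τ n k} → Formula τ k → (Carrier → Carrier → Carrier) →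
           Interpretation K τ n → Vec (Fin n) k → Carrier
  ⟦ ψ ⟧inf _⊓_ = ⟦ ψ ⟧ _⊓_

-- Both valuations are computed by the same recursion and differ only in
-- interpreting ∧ and ∀ by · or by ⊓, so it suffices to exhibit relations
-- between the two values that are preserved by 0, 1, the literals, +, and
-- the pair (·, ⊓).  For (i) this is the natural order, since a · b lies
-- below both a and b.  For (ii) it is "u lies above some power of v":
-- expanding (a + b)^(m + n) every monomial is below a^m or b^n, and
-- (a ⊓ b)^(m + n) ≤ a^m · b^n.  As 1 is the top element, π_inf⟦ψ⟧ = 1 then
-- forces π⟦ψ⟧ ≥ 1^N = 1, while π⟦ψ⟧ = 1 forces π_inf⟦ψ⟧ ≥ 1 by (i).
module Submission where

open import Defs
open import Data.Nat as ℕ using (ℕ; zero; suc)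
open import Data.Nat.Properties using (+-suc)
open import Data.Fin using (Fin)
open import Data.Fin.Properties using (_≟_)
open import Data.Vec using (Vec; lookup; _∷_)
open import Data.Product using (_×_; _,_; ∃-syntax)
open import Relation.Nullary using (yes; no)
open import Relation.Binary.Core using (Rel)
open import Relation.Binary.Structures using (IsPartialOrder)
open import Relation.Binary.Bundles using (Poset)
open import Algebra.Bundles using (CommutativeSemiring)
import Algebra.Properties.CommutativeSemigroup as CommutativeSemigroupProperties
import Algebra.Properties.Semiring.Exp as SemiringExp
import Relation.Binary.Reasoning.Setoid as SetoidReasoning
import Relation.Binary.Reasoning.PartialOrder as PosetReasoning

module SimulationLemma {c ℓ} (K : CommutativeSemiring c ℓ) where
  open CommutativeSemiring K using (Carrier; _+_; 0#; 1#)
  open Semantics K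

  module _ {r} (R : Rel Carrier r) (_·_ _∘_ : Carrier → Carrier → Carrier)
           (R-refl : ∀ x → R x x)
           (R-+ : ∀ {x y u v} → R x y → R u v → R (x + u) (y + v))
           (R-·∘ : ∀ {x y u v} → R x y → R u v → R (x · u) (y ∘ v)) where

    bigSum-preserves : ∀ {n} {f g : Fin n → Carrier} →
      (∀ i → R (f i) (g i)) → R (bigSum f) (bigSum g)
    bigSum-preserves {zero}  fRg = R-refl 0#
    bigSum-preserves {suc n} fRg =
      R-+ (fRg Fin.zero) (bigSum-preserves (λ i → fRg (Fin.suc i)))

    bigMul-preserves : ∀ {n} {f g : Fin n → Carrier} →
      (∀ i → R (f i) (g i)) → R (bigMul _·_ f) (bigMul _∘_ g)
    bigMul-preserves {zero}  fRg = R-refl 1#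
    bigMul-preserves {suc n} fRg =
      R-·∘ (fRg Fin.zero) (bigMul-preserves (λ i → fRg (Fin.suc i)))

    ⟦⟧-preserves : ∀ {τ n k} (π : Interpretation K τ n) (ψ : Formula τ k)
      (as : Vec (Fin n) k) → R (⟦ ψ ⟧ _·_ π as) (⟦ ψ ⟧ _∘_ π as)
    ⟦⟧-preserves π (eq x y) as with lookup as x ≟ lookup as y
    ... | yes _ = R-refl 1#
    ... | no  _ = R-refl 0#
    ⟦⟧-preserves π (neq x y) as with lookup as x ≟ lookup as y
    ... | yes _ = R-refl 0#
    ... | no  _ = R-refl 1#
    ⟦⟧-preserves π (pos P xs) as = R-refl _
    ⟦⟧-preserves π (neg P xs) as = R-refl _
    ⟦⟧-preserves π (φ ∨ ψ) as = R-+ (⟦⟧-preserves π φ as) (⟦⟧-preserves π ψ as)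
    ⟦⟧-preserves π (φ ∧ ψ) as = R-·∘ (⟦⟧-preserves π φ as) (⟦⟧-preserves π ψ as)
    ⟦⟧-preserves π (ex φ) as = bigSum-preserves (λ a → ⟦⟧-preserves π φ (a ∷ as))
    ⟦⟧-preserves π (all φ) as = bigMul-preserves (λ a → ⟦⟧-preserves π φ (a ∷ as))

module AbsorptiveSemiring {c ℓ} (K : CommutativeSemiring c ℓ) (absorptive : Absorptive K) where
  open CommutativeSemiring K hiding (zero)
  open SemiringExp semiring using (_^_; ^-congʳ)
  open CommutativeSemigroupProperties +-commutativeSemigroup using (interchange)

  infix 4 _≤_
  _≤_ : Rel Carrier ℓ
  _≤_ = _≤K_ K

  +-idem : ∀ x → x + x ≈ x
  +-idem x = begin
    x + x       ≈⟨ +-congˡ (*-identityʳ x) ⟨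
    x + x * 1#  ≈⟨ absorptive x 1# ⟩
    x           ∎
    where open SetoidReasoning setoid

  ≤-isPartialOrder : IsPartialOrder _≈_ _≤_
  ≤-isPartialOrder = record
    { isPreorder = record
      { isEquivalence = isEquivalence
      ; reflexive     = λ {x} {y} x≈y → trans (+-congʳ x≈y) (+-idem y)
      ; trans         = ≤-trans
      }
    ; antisym = λ {x} {y} x≤y y≤x → trans (sym y≤x) (trans (+-comm y x) x≤y)
    }
    where
    ≤-trans : ∀ {x y z} → x ≤ y → y ≤ z → x ≤ z
    ≤-trans {x} {y} {z} x≤y y≤z = begin
      x + z        ≈⟨ +-congˡ y≤z ⟨
      x + (y + z)  ≈⟨ +-assoc x y z ⟨
      (x + y) + z  ≈⟨ +-congʳ x≤y ⟩
      y + z        ≈⟨ y≤z ⟩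
      z            ∎
      where open SetoidReasoning setoid

  ≤-poset : Poset c ℓ ℓ
  ≤-poset = record { isPartialOrder = ≤-isPartialOrder }

  open Poset ≤-poset public using (≤-respˡ-≈) renaming
    (refl to ≤-refl; reflexive to ≤-reflexive; trans to ≤-trans; antisym to ≤-antisym)

  x≤1 : ∀ x → x ≤ 1#
  x≤1 x = begin
    x + 1#       ≈⟨ +-comm x 1# ⟩
    1# + x       ≈⟨ +-congˡ (*-identityˡ x) ⟨
    1# + 1# * x  ≈⟨ absorptive 1# x ⟩
    1#           ∎
    where open SetoidReasoning setoid

  1≤x⇒x≈1 : ∀ {x} → 1# ≤ x → x ≈ 1#
  1≤x⇒x≈1 {x} 1≤x = ≤-antisym (x≤1 x) 1≤x

  x≤x+y : ∀ x y → x ≤ x + y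
  x≤x+y x y = trans (sym (+-assoc x x y)) (+-congʳ (+-idem x))

  y≤x+y : ∀ x y → y ≤ x + y
  y≤x+y x y = ≤-trans (x≤x+y y x) (≤-reflexive (+-comm y x))

  +-lub : ∀ {x y z} → x ≤ z → y ≤ z → x + y ≤ z
  +-lub {x} {y} {z} x≤z y≤z = trans (+-assoc x y z) (trans (+-congˡ y≤z) x≤z)

  +-mono-≤ : ∀ {x y u v} → x ≤ y → u ≤ v → x + u ≤ y + v
  +-mono-≤ {x} {y} {u} {v} x≤y u≤v = trans (interchange x u y v) (+-cong x≤y u≤v)

  *-monoˡ-≤ : ∀ z {x y} → x ≤ y → x * z ≤ y * z
  *-monoˡ-≤ z {x} {y} x≤y = trans (sym (distribʳ z x y)) (*-congʳ x≤y)

  *-monoʳ-≤ : ∀ z {x y} → x ≤ y → z * x ≤ z * y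
  *-monoʳ-≤ z {x} {y} x≤y =
    trans (+-cong (*-comm z x) (*-comm z y)) (trans (*-monoˡ-≤ z x≤y) (*-comm y z))

  *-mono-≤ : ∀ {x y u v} → x ≤ y → u ≤ v → x * u ≤ y * v
  *-mono-≤ {y = y} {u = u} x≤y u≤v = ≤-trans (*-monoˡ-≤ u x≤y) (*-monoʳ-≤ y u≤v)

  x*y≤x : ∀ x y → x * y ≤ x
  x*y≤x x y = trans (+-comm (x * y) x) (absorptive x y)

  x*y≤y : ∀ x y → x * y ≤ y
  x*y≤y x y = ≤-trans (≤-reflexive (*-comm x y)) (x*y≤x y x)

  ^-mono-≤ : ∀ n {x y} → x ≤ y → x ^ n ≤ y ^ n
  ^-mono-≤ zero    x≤y = ≤-refl
  ^-mono-≤ (suc n) x≤y = *-mono-≤ x≤y (^-mono-≤ n x≤y)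

  1^n≈1 : ∀ n → 1# ^ n ≈ 1#
  1^n≈1 zero    = refl
  1^n≈1 (suc n) = trans (*-identityˡ (1# ^ n)) (1^n≈1 n)

  x*[y+z]≤x*y+z : ∀ x y z → x * (y + z) ≤ x * y + z
  x*[y+z]≤x*y+z x y z =
    ≤-trans (≤-reflexive (distribˡ x y z)) (+-mono-≤ ≤-refl (x*y≤y x z))

  x*[y+z]≤y+x*z : ∀ x y z → x * (y + z) ≤ y + x * z
  x*[y+z]≤y+x*z x y z =
    ≤-trans (≤-reflexive (distribˡ x y z)) (+-mono-≤ (x*y≤y x y) ≤-refl)

  [x+y]^[m+n]≤x^m+y^n : ∀ x y m n → (x + y) ^ (m ℕ.+ n) ≤ x ^ m + y ^ n
  [x+y]^[m+n]≤x^m+y^n x y zero    n       = ≤-trans (x≤1 _) (x≤x+y 1# (y ^ n))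
  [x+y]^[m+n]≤x^m+y^n x y (suc m) zero    = ≤-trans (x≤1 _) (y≤x+y (x ^ suc m) 1#)
  [x+y]^[m+n]≤x^m+y^n x y (suc m) (suc n) = begin
    s * s ^ (m ℕ.+ suc n)
      ≈⟨ distribʳ _ x y ⟩
    x * s ^ (m ℕ.+ suc n) + y * s ^ (m ℕ.+ suc n)
      ≈⟨ +-congˡ (*-congˡ (^-congʳ s (+-suc m n))) ⟩
    x * s ^ (m ℕ.+ suc n) + y * s ^ (suc m ℕ.+ n)
      ≤⟨ +-mono-≤ (*-monoʳ-≤ x ([x+y]^[m+n]≤x^m+y^n x y m (suc n)))
                  (*-monoʳ-≤ y ([x+y]^[m+n]≤x^m+y^n x y (suc m) n)) ⟩
    x * (x ^ m + y ^ suc n) + y * (x ^ suc m + y ^ n)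
      ≤⟨ +-lub (x*[y+z]≤x*y+z x _ _) (x*[y+z]≤y+x*z y _ _) ⟩
    x ^ suc m + y ^ suc n
      ∎
    where
    open PosetReasoning ≤-poset
    s : Carrier
    s = x + y

module WithInfimum {c ℓ} (K : CommutativeSemiring c ℓ) (absorptive : Absorptive K)
  (_⊓_ : CommutativeSemiring.Carrier K → CommutativeSemiring.Carrier K → CommutativeSemiring.Carrier K)
  (isInfimum : IsInfimum K _⊓_) where
  open CommutativeSemiring K hiding (zero)
  open SemiringExp semiring using (_^_; ^-congˡ; ^-homo-*)
  open AbsorptiveSemiring K absorptive

  x⊓y≤x : ∀ x y → x ⊓ y ≤ x
  x⊓y≤x x y with isInfimum x y
  ... | x⊓y≤x , _ , _ = x⊓y≤x

  x⊓y≤y : ∀ x y → x ⊓ y ≤ y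
  x⊓y≤y x y with isInfimum x y
  ... | _ , x⊓y≤y , _ = x⊓y≤y

  ⊓-greatest : ∀ {x y z} → z ≤ x → z ≤ y → z ≤ x ⊓ y
  ⊓-greatest {x} {y} {z} with isInfimum x y
  ... | _ , _ , greatest = greatest z

  x*y≤x⊓y : ∀ x y → x * y ≤ x ⊓ y
  x*y≤x⊓y x y = ⊓-greatest (x*y≤x x y) (x*y≤y x y)

  [x⊓y]^[m+n]≤x^m*y^n : ∀ x y m n → (x ⊓ y) ^ (m ℕ.+ n) ≤ x ^ m * y ^ n
  [x⊓y]^[m+n]≤x^m*y^n x y m n = ≤-trans (≤-reflexive (^-homo-* (x ⊓ y) m n))
    (*-mono-≤ (^-mono-≤ m (x⊓y≤x x y)) (^-mono-≤ n (x⊓y≤y x y)))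

  AbovePowerOf : Rel Carrier ℓ
  AbovePowerOf u v = ∃[ n ] v ^ n ≤ u

  abovePowerOf-refl : ∀ x → AbovePowerOf x x
  abovePowerOf-refl x = 1 , ≤-reflexive (*-identityʳ x)

  abovePowerOf-+ : ∀ {x y u v} → AbovePowerOf x y → AbovePowerOf u v →
    AbovePowerOf (x + u) (y + v)
  abovePowerOf-+ {y = y} {v = v} (m , yᵐ≤x) (n , vⁿ≤u) =
    m ℕ.+ n , ≤-trans ([x+y]^[m+n]≤x^m+y^n y v m n) (+-mono-≤ yᵐ≤x vⁿ≤u)

  abovePowerOf-*⊓ : ∀ {x y u v} → AbovePowerOf x y → AbovePowerOf u v →
    AbovePowerOf (x * u) (y ⊓ v)
  abovePowerOf-*⊓ {y = y} {v = v} (m , yᵐ≤x) (n , vⁿ≤u) =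
    m ℕ.+ n , ≤-trans ([x⊓y]^[m+n]≤x^m*y^n y v m n) (*-mono-≤ yᵐ≤x vⁿ≤u)

  abovePowerOf-1 : ∀ {u v} → AbovePowerOf u v → v ≈ 1# → u ≈ 1#
  abovePowerOf-1 {u} (n , vⁿ≤u) v≈1 =
    1≤x⇒x≈1 (≤-trans (≤-reflexive (sym (trans (^-congˡ n v≈1) (1^n≈1 n)))) vⁿ≤u)

mainTheorem14 : ∀ {c ℓ} (K : CommutativeSemiring c ℓ) → Absorptive K →
    (_⊓_ : CommutativeSemiring.Carrier K → CommutativeSemiring.Carrier K → CommutativeSemiring.Carrier K) →
    IsInfimum K _⊓_ →
    (τ : Vocabulary) (n : ℕ) (π : Interpretation K τ n) →
    ∀ {k} (ψ : Formula τ k) (as : Vec (Fin n) k) →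
      _≤K_ K (Semantics.⟦_⟧K K ψ π as) (Semantics.⟦_⟧inf K ψ _⊓_ π as)
      × ((CommutativeSemiring._≈_ K (Semantics.⟦_⟧inf K ψ _⊓_ π as) (CommutativeSemiring.1# K)
          → CommutativeSemiring._≈_ K (Semantics.⟦_⟧K K ψ π as) (CommutativeSemiring.1# K))
        × (CommutativeSemiring._≈_ K (Semantics.⟦_⟧K K ψ π as) (CommutativeSemiring.1# K)
          → CommutativeSemiring._≈_ K (Semantics.⟦_⟧inf K ψ _⊓_ π as) (CommutativeSemiring.1# K)))
mainTheorem14 K absorptive _⊓_ isInfimum τ n π ψ as =
  π≤πinf , abovePowerOf-1 πAbovePowerOfπinf , λ π≈1 → 1≤x⇒x≈1 (≤-respˡ-≈ π≈1 π≤πinf)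
  where
  open CommutativeSemiring K using (_*_)
  open Semantics K using (⟦_⟧K; ⟦_⟧inf)
  open AbsorptiveSemiring K absorptive
  open WithInfimum K absorptive _⊓_ isInfimum
  open SimulationLemma K

  π≤πinf : ⟦ ψ ⟧K π as ≤ ⟦ ψ ⟧inf _⊓_ π as
  π≤πinf = ⟦⟧-preserves _≤_ _*_ _⊓_ (λ _ → ≤-refl) +-mono-≤
    (λ x≤y u≤v → ≤-trans (*-mono-≤ x≤y u≤v) (x*y≤x⊓y _ _)) π ψ as

  πAbovePowerOfπinf : AbovePowerOf (⟦ ψ ⟧K π as) (⟦ ψ ⟧inf _⊓_ π as)
  πAbovePowerOfπinf = ⟦⟧-preserves AbovePowerOf _*_ _⊓_ abovePowerOf-refl
    abovePowerOf-+ abovePowerOf-*⊓ π ψ as
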